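{- Let $(D,\sqsubseteq,\oplus,\mathcal B)$ be an interpretation monoid whose basis is the irreducible basis $\mathcal B=\mathrm{Ir}(D)\cup\{\bot\}$, let every elementary command be equipped with a basis semantics as described in the context, and assume that the full semantics $[\![r]\!]$ is additive for every regular command $r$ and that $\oplus$ preserves additivity. Then the rules (basic), (seq), (choice), (iter) and (cons) alone form a relatively complete proof system: for all $h,k\in D$ and every regular command $r$, if $[\![r]\!]\,h\sqsubseteq k$ then $\vdash\{h\}\ r\ \{k\}$ is derivable using only these five rules (with assertions ranging over $D$).
   Context: Interpretation monoids. Let $(D,\sqsubseteq)$ be a complete lattice with join $\sqcup$, bottom $\bot$. A (join) basis of $D$ is a subset $\mathcal B\subseteq D$ such that every $d\in D$ satisfies $d=\bigsqcup \mathcal B_d$, where $\mathcal B_d=\{b\in\mathcal B\mid b\sqsubseteq d\}$; it is pointed if $\bot\in\mathcal B$. An element $d$ is completely join-irreducible if $d=\bigsqcup X$ implies $d\in X$ for every $X\subseteq D$; $\mathrm{Ir}(D)$ is the set of such elements, and "irreducible basis" means $\mathrm{Ir}(D)\cup\{\bot\}$ is a basis and is the basis used. For $X\subseteq D$, $\downarrow X=\{d\mid \exists x\in X.\ d\sqsubseteq x\}$. The weight of $d$ w.r.t. $\mathcal B$ is $w(d)=\min\{|Y|: Y\subseteq\mathcal B_d,\ \downarrow Y=\downarrow\mathcal B_d\}$ and $w(X)=\sup_{d\in X}w(d)$. A complete monoid $(M,\oplus)$ assigns to every family $(m_i)_{i\in I}$ ($I$ arbitrary) an element $\bigoplus_{i\in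 I}m_i$ with $\bigoplus_{i\in\{j\}}m_i=m_j$ and $\bigoplus_{i\in I}m_i=\bigoplus_{j\in J}\bigoplus_{i\in I_j}m_i$ for every partition $(I_j)_{j\in J}$ of $I$; $0_\oplus$ is the empty sum. For $S\subseteq M$, $\langle S\rangle$ is the least complete submonoid containing $S$. An ordered complete monoid is a complete monoid with a partial order for which $\oplus$ is monotone in all arguments. For a cardinal $\kappa$, a $\kappa$-quantale is an ordered complete monoid in which every subset of cardinality $\le\kappa$ has a join and, for every index set $I$, nonempty index sets $J_i$ with $|J_i|\le\kappa$ and elements $x_{i,j}$, $\bigoplus_{i\in I}\bigsqcup_{j\in J_i}x_{i,j}=\bigsqcup_{\beta}\bigoplus_{i\in I}x_{i,\beta(i)}$ ($\beta$ ranging over functions with $\beta(i)\in J_i$; the right-hand join is required to exist). An interpretation monoid $(D,\sqsubseteq,\oplus,\mathcal B)$: $(D,\sqsubseteq,\oplus)$ ordered complete monoid, $(D,\sqsubseteq)$ complete lattice, $\mathcal B$ pointed basis, and $\langle\mathcal B\rangle$ is a $\kappa_D$-quantale with $\kappa_D=w(\langle\mathcal B\rangle)$. Commands and semantics. Regular commands $r::= e\mid r;r\mid r+r\mid r^*$ over elementary commands including $\mathsf 0,\mathsf 1$; $r^0=\mathsf 1$, $r^{i+1}=r;r^i$. For $f:\mathcal B\to D$, $f^+(d)=\bigsqcup_{b\in\mathcal B_d}f(b)$. Each elementary $e$ has a monotone $[\![e]\!]_{\mathcal B}:\mathcal B\to\langle\mathcal B\rangle$ with $[\![\mathsf 0]\!]_{\mathcal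 B}b=0_\oplus$, $[\![\mathsf 1]\!]_{\mathcal B}b=b$; $[\![r_1;r_2]\!]_{\mathcal B}b=([\![r_2]\!]_{\mathcal B})^+([\![r_1]\!]_{\mathcal B}b)$, $[\![r_1+r_2]\!]_{\mathcal B}b=[\![r_1]\!]_{\mathcal B}b\oplus[\![r_2]\!]_{\mathcal B}b$, $[\![r^*]\!]_{\mathcal B}b=\bigoplus_{i\ge0}[\![r^i]\!]_{\mathcal B}b$; full semantics $[\![r]\!]=([\![r]\!]_{\mathcal B})^+$. A function $f:D\to D$ is additive if $f(\bigsqcup X)=\bigsqcup_{x\in X}f(x)$ for all $X\subseteq D$. For functions $f_i:D\to D$, $(\bigoplus_{i\in I}f_i)(d)=\bigoplus_{i\in I}f_i(d)$; $\oplus$ preserves additivity if $\bigoplus_{i\in I}f_i$ is additive whenever every $f_i$ is. Rules (assertions in $D$): (basic) if $[\![e]\!]h\sqsubseteq k$ then $\vdash\{h\}e\{k\}$; (seq) from $\vdash\{h\}r_1\{k'\}$, $\vdash\{k'\}r_2\{k\}$ infer $\vdash\{h\}r_1;r_2\{k\}$; (cons) from $h\sqsubseteq h'$, $\vdash\{h'\}r\{k'\}$, $k'\sqsubseteq k$ infer $\vdash\{h\}r\{k\}$; (choice) from $\vdash\{h\}r_1\{k_1\}$, $\vdash\{h\}r_2\{k_2\}$, $k_1\oplus k_2\sqsubseteq k$ infer $\vdash\{h\}r_1+r_2\{k\}$; (iter) from $\vdash\{h_i\}r\{h_{i+1}\}$ for all $i\in\mathbb N$ and $\bigoplus_{i\in\mathbb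 N}h_i\sqsubseteq k$ infer $\vdash\{h_0\}r^*\{k\}$. -}

module Defs where

open import Data.Nat using (ℕ; zero; suc)
open import Data.Bool using (Bool; true; false; if_then_else_)
open import Data.Empty using (⊥)
open import Data.Product using (Σ; ∃; _×_; _,_; proj₁; proj₂)
open import Data.Sum using (_⊎_)
open import Relation.Binary.PropositionalEquality using (_≡_)
open import Function.Bundles using (_⇔_)

-- |Y| ≤ |L| for a subset Y ⊆ A: an injection of the *elements* of Y into L
SubInj : {A : Set} → (A → Set) → Set → Set
SubInj {A} Y L = Σ (Σ A Y → L) λ f → ∀ a b → f a ≡ f b → proj₁ a ≡ proj₁ b

TyInj : Set → Set → Set
TyInj J L = Σ (J → L) λ f → ∀ a b → f a ≡ f b → a ≡ b

record PreInterpretationMonoid : Set₁ where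
  infix 4 _⊑_
  field
    D    : Set
    _⊑_  : D → D → Set
    ⊑-refl    : ∀ {x} → x ⊑ x
    ⊑-trans   : ∀ {x y z} → x ⊑ y → y ⊑ z → x ⊑ z
    ⊑-antisym : ∀ {x y} → x ⊑ y → y ⊑ x → x ≡ y
    ⋁        : (D → Set) → D
    ⋁-upper  : ∀ (X : D → Set) x → X x → x ⊑ ⋁ X
    ⋁-least  : ∀ (X : D → Set) u → (∀ x → X x → x ⊑ u) → ⋁ X ⊑ u
    ⨁ : {I : Set} → (I → D) → D
    ⨁-single : ∀ (I : Set) (m : I → D) (j : I) → (∀ i → i ≡ j) → ⨁ m ≡ m j
    -- a partition (I_j)_{j∈J} of I is given by the block map p : I → J,
    -- I_j = {i | p i ≡ j}
    ⨁-partition : ∀ (I J : Set) (m : I → D) (p : I → J) →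
      ⨁ m ≡ ⨁ (λ (j : J) → ⨁ (λ (x : Σ I (λ i → p i ≡ j)) → m (proj₁ x)))
    ⨁-mono : ∀ (I : Set) (m n : I → D) → (∀ i → m i ⊑ n i) → ⨁ m ⊑ ⨁ n
    B : D → Set
    B-pointed : B (⋁ (λ _ → ⊥))
    B-basis   : ∀ d → d ≡ ⋁ (λ b → B b × b ⊑ d)

module Notions (P : PreInterpretationMonoid) where
  open PreInterpretationMonoid P public

  ⊥D : D
  ⊥D = ⋁ (λ _ → ⊥)

  infixl 6 _⊕_
  _⊕_ : D → D → D
  x ⊕ y = ⨁ (λ (c : Bool) → if c then x else y)

  0⊕ : D
  0⊕ = ⨁ {⊥} (λ ())

  Bd : D → D → Set
  Bd d b = B b × b ⊑ d

  ↓ : (D → Set) → D → Set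
  ↓ X e = Σ D λ x → X x × e ⊑ x

  Ir : D → Set₁
  Ir d = ∀ (X : D → Set) → d ≡ ⋁ X → X d

  -- ⟨𝓑⟩ : least complete submonoid containing 𝓑 (inductive closure)
  data Gen : D → Set₁ where
    gen-base : ∀ {d} → B d → Gen d
    gen-sum  : ∀ (I : Set) (m : I → D) → (∀ i → Gen (m i)) → Gen (⨁ m)

  -- Y witnesses "w(d) ≤ |L|": Y ⊆ 𝓑_d, ↓Y = ↓𝓑_d, |Y| ≤ |L|
  WeightWitness : D → Set → Set₁
  WeightWitness d L = Σ (D → Set) λ Y →
    (∀ y → Y y → Bd d y) × (∀ e → ↓ Y e ⇔ ↓ (Bd d) e) × SubInj Y L

  -- κ_D ≤ |L|  (i.e. w(d) ≤ |L| for all d ∈ ⟨𝓑⟩)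
  κ≤ : Set → Set₁
  κ≤ L = ∀ d → Gen d → WeightWitness d L

  -- |J| ≤ κ_D, κ_D = sup_{d ∈ ⟨𝓑⟩} w(d): |J| ≤ λ for every cardinal λ ≥ κ_D
  TyLeκ : Set → Set₁
  TyLeκ J = ∀ (L : Set) → κ≤ L → TyInj J L

  SubLeκ : (D → Set) → Set₁
  SubLeκ X = ∀ (L : Set) → κ≤ L → SubInj X L

  IsJoinIn⟨B⟩ : (D → Set) → D → Set₁
  IsJoinIn⟨B⟩ X u =
    Gen u × (∀ x → X x → x ⊑ u) × (∀ v → Gen v → (∀ x → X x → x ⊑ v) → u ⊑ v)

  Img : {J : Set} → (J → D) → D → Set
  Img {J} x d = Σ J λ j → x j ≡ d

  ext : (D → D) → D → D
  ext f d = ⋁ (λ y → Σ D λ b → Bd d b × f b ≡ y)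

  Additive : (D → D) → Set₁
  Additive f = ∀ (X : D → Set) → f (⋁ X) ≡ ⋁ (λ y → Σ D λ x → X x × f x ≡ y)

record IsInterpretationMonoid (P : PreInterpretationMonoid) : Set₁ where
  open Notions P
  field
    quantale-joins : ∀ (X : D → Set) → (∀ x → X x → Gen x) → SubLeκ X →
      Σ D λ u → IsJoinIn⟨B⟩ X u
    quantale-distrib : ∀ (I : Set) (J : I → Set) → (∀ i → J i) →
      (∀ i → TyLeκ (J i)) → (x : (i : I) → J i → D) → (∀ i j → Gen (x i j)) →
      (u : I → D) → (∀ i → IsJoinIn⟨B⟩ (Img (x i)) (u i)) →
      IsJoinIn⟨B⟩ (λ d → Σ ((i : I) → J i) λ β → ⨁ (λ i → x i (β i)) ≡ d) (⨁ u)

data RegCmd (E : Set) : Set where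
  elem : E → RegCmd E
  _⨾_  : RegCmd E → RegCmd E → RegCmd E
  _+ᶜ_ : RegCmd E → RegCmd E → RegCmd E
  _*ᶜ  : RegCmd E → RegCmd E

record BasisSemantics (P : PreInterpretationMonoid) : Set₁ where
  open Notions P
  field
    E     : Set
    𝟘 𝟙   : E
    ⟦_⟧e  : E → D → D      -- only its values on 𝓑 are ever used
    e-mono : ∀ e b b' → B b → B b' → b ⊑ b' → ⟦ e ⟧e b ⊑ ⟦ e ⟧e b'
    e-gen  : ∀ e b → B b → Gen (⟦ e ⟧e b)
    𝟘-sem  : ∀ b → B b → ⟦ 𝟘 ⟧e b ≡ 0⊕
    𝟙-sem  : ∀ b → B b → ⟦ 𝟙 ⟧e b ≡ b

module Semantics (P : PreInterpretationMonoid) (S : BasisSemantics P) where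
  open Notions P public
  open BasisSemantics S public

  Cmd : Set
  Cmd = RegCmd E

  pow : Cmd → ℕ → Cmd
  pow r zero    = elem 𝟙
  pow r (suc i) = r ⨾ pow r i

  -- ⟦r⟧_𝓑 ; semPow r i = ⟦r^i⟧_𝓑 (written by recursion on i for termination)
  mutual
    ⟦_⟧B : Cmd → D → D
    ⟦ elem e ⟧B b   = ⟦ e ⟧e b
    ⟦ r₁ ⨾ r₂ ⟧B b  = ext ⟦ r₂ ⟧B (⟦ r₁ ⟧B b)
    ⟦ r₁ +ᶜ r₂ ⟧B b = ⟦ r₁ ⟧B b ⊕ ⟦ r₂ ⟧B b
    ⟦ r *ᶜ ⟧B b     = ⨁ (λ (i : ℕ) → semPow r i b)

    semPow : Cmd → ℕ → D → D
    semPow r zero b    = ⟦ 𝟙 ⟧e b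
    semPow r (suc i) b = ext (semPow r i) (⟦ r ⟧B b)

  ⟦_⟧ : Cmd → D → D
  ⟦ r ⟧ = ext ⟦ r ⟧B

  data ⊢⟨_⟩_⟨_⟩ : D → Cmd → D → Set₁ where
    basic  : ∀ {h k e} → ⟦ elem e ⟧ h ⊑ k → ⊢⟨ h ⟩ elem e ⟨ k ⟩
    seq    : ∀ {h k' k r₁ r₂} → ⊢⟨ h ⟩ r₁ ⟨ k' ⟩ → ⊢⟨ k' ⟩ r₂ ⟨ k ⟩ →
             ⊢⟨ h ⟩ r₁ ⨾ r₂ ⟨ k ⟩
    cons   : ∀ {h h' k' k r} → h ⊑ h' → ⊢⟨ h' ⟩ r ⟨ k' ⟩ → k' ⊑ k →
             ⊢⟨ h ⟩ r ⟨ k ⟩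
    choice : ∀ {h k₁ k₂ k r₁ r₂} → ⊢⟨ h ⟩ r₁ ⟨ k₁ ⟩ → ⊢⟨ h ⟩ r₂ ⟨ k₂ ⟩ →
             k₁ ⊕ k₂ ⊑ k → ⊢⟨ h ⟩ r₁ +ᶜ r₂ ⟨ k ⟩
    iter   : ∀ {k r} (hs : ℕ → D) → (∀ i → ⊢⟨ hs i ⟩ r ⟨ hs (suc i) ⟩) →
             ⨁ hs ⊑ k → ⊢⟨ hs zero ⟩ r *ᶜ ⟨ k ⟩

{-# OPTIONS --safe #-}
-- Strongest postconditions: by induction on r, ⊢⟨ h ⟩ r ⟨ k ⟩ is derived with
-- intermediate assertions ⟦ r₁ ⟧ h (for r₁ ⨾ r₂), ⟦ r₁ ⟧ h and ⟦ r₂ ⟧ h (for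
-- r₁ +ᶜ r₂) and the iterates ⟦ r ⟧ⁱ h (for r *ᶜ). Additivity of ⟦ _ ⟧ and of
-- pointwise sums pushes the semantics through the joins over the basis that
-- define ⟦ _ ⟧ = ext ⟦ _ ⟧B, which bounds the composed assertions by ⟦ r ⟧ h.
module Submission where

open import Defs
open import Data.Sum using (_⊎_)
open import Relation.Binary.PropositionalEquality using (_≡_; refl; sym; trans; cong; subst)
open import Function.Bundles using (_⇔_)
open import Function.Base using (_∘_)
open import Data.Nat using (ℕ; zero; suc)
open import Data.Nat.GeneralisedArithmetic using (fold; iterate; iterate-is-fold)
open import Data.Bool using (Bool; true; false; if_then_else_)
open import Data.Product using (_,_)

module Extension (P : PreInterpretationMonoid) where
  open Notions P

  ≡⇒⊑ : ∀ {x y} → x ≡ y → x ⊑ y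
  ≡⇒⊑ refl = ⊑-refl

  ⋁-mono : ∀ {X Y : D → Set} → (∀ x → X x → Y x) → ⋁ X ⊑ ⋁ Y
  ⋁-mono {X} {Y} X⊆Y = ⋁-least X (⋁ Y) λ x Xx → ⋁-upper Y x (X⊆Y x Xx)

  ext-mono : ∀ f {d d'} → d ⊑ d' → ext f d ⊑ ext f d'
  ext-mono f d⊑d' = ⋁-mono λ { y (b , (Bb , b⊑d) , fb≡y) → b , (Bb , ⊑-trans b⊑d d⊑d') , fb≡y }

  ext-cong : ∀ {f g} → (∀ b → f b ≡ g b) → ∀ d → ext f d ≡ ext g d
  ext-cong f≗g d = ⊑-antisym
    (⋁-mono λ { y (b , b∈d , fb≡y) → b , b∈d , trans (sym (f≗g b)) fb≡y })
    (⋁-mono λ { y (b , b∈d , gb≡y) → b , b∈d , trans (f≗g b) gb≡y })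

  Additive-cong : ∀ {f g} → (∀ d → f d ≡ g d) → Additive f → Additive g
  Additive-cong f≗g f-additive X = trans (sym (f≗g (⋁ X))) (trans (f-additive X) (⊑-antisym
    (⋁-mono λ { y (x , Xx , fx≡y) → x , Xx , trans (sym (f≗g x)) fx≡y })
    (⋁-mono λ { y (x , Xx , gx≡y) → x , Xx , trans (f≗g x) gx≡y })))

  MonotoneOnBasis : (D → D) → Set
  MonotoneOnBasis f = ∀ b b' → B b → B b' → b ⊑ b' → f b ⊑ f b'

  ext-⊑-onBasis : ∀ {f} → MonotoneOnBasis f → ∀ b → B b → ext f b ⊑ f b
  ext-⊑-onBasis {f} f-mono b Bb = ⋁-least _ _
    λ { y (b' , (Bb' , b'⊑b) , fb'≡y) → subst (_⊑ f b) fb'≡y (f-mono b' b Bb' Bb b'⊑b) }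

  ⊑-ext : ∀ {f} → (∀ b → B b → b ⊑ f b) → ∀ d → d ⊑ ext f d
  ⊑-ext {f} b⊑fb d = ⊑-trans (≡⇒⊑ (B-basis d))
    (⋁-least _ _ λ b (Bb , b⊑d) → ⊑-trans (b⊑fb b Bb) (⋁-upper _ (f b) (b , (Bb , b⊑d) , refl)))

  additive-ext-⊑ : ∀ {g} → Additive g → ∀ f d → g (ext f d) ⊑ ext (g ∘ f) d
  additive-ext-⊑ g-additive f d = ⊑-trans (≡⇒⊑ (g-additive _))
    (⋁-least _ _ λ { y (_ , (b , b∈d , refl) , refl) → ⋁-upper _ y (b , b∈d , refl) })

  ⨁PreservesAdditivity : Set₁
  ⨁PreservesAdditivity = ∀ (I : Set) (f : I → D → D) → (∀ i → Additive (f i)) →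
    Additive (λ d → ⨁ (λ i → f i d))

  ⨁-ext-⊑ : ⨁PreservesAdditivity → ∀ {I : Set} (f : I → D → D) →
    (∀ i → Additive (ext (f i))) → (∀ i → MonotoneOnBasis (f i)) →
    ∀ d → ⨁ (λ i → ext (f i) d) ⊑ ext (λ b → ⨁ (λ i → f i b)) d
  ⨁-ext-⊑ ⨁-additive f ext-additive f-mono d =
    ⊑-trans (≡⇒⊑ (cong Σext (B-basis d))) (⊑-trans (≡⇒⊑ (Σext-additive (Bd d)))
      (⋁-least _ _ λ { y (b , (Bb , b⊑d) , refl) → ⊑-trans
        (⨁-mono _ _ _ λ i → ext-⊑-onBasis (f-mono i) b Bb)
        (⋁-upper _ _ (b , (Bb , b⊑d) , refl)) }))
    where
      Σext : D → D
      Σext d = ⨁ (λ i → ext (f i) d)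

      Σext-additive : Additive Σext
      Σext-additive = ⨁-additive _ (λ i → ext (f i)) ext-additive

module Completeness (P : PreInterpretationMonoid) (S : BasisSemantics P) where
  open Semantics P S
  open Extension P

  mutual
    ⟦⟧B-mono : ∀ r → MonotoneOnBasis ⟦ r ⟧B
    ⟦⟧B-mono (elem e) = e-mono e
    ⟦⟧B-mono (r₁ ⨾ r₂) b b' Bb Bb' b⊑b' = ext-mono ⟦ r₂ ⟧B (⟦⟧B-mono r₁ b b' Bb Bb' b⊑b')
    ⟦⟧B-mono (r₁ +ᶜ r₂) b b' Bb Bb' b⊑b' = ⨁-mono Bool _ _ λ
      { true → ⟦⟧B-mono r₁ b b' Bb Bb' b⊑b' ; false → ⟦⟧B-mono r₂ b b' Bb Bb' b⊑b' }
    ⟦⟧B-mono (r *ᶜ) b b' Bb Bb' b⊑b' = ⨁-mono ℕ _ _ λ i → semPow-mono r i b b' Bb Bb' b⊑b'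

    semPow-mono : ∀ r i → MonotoneOnBasis (semPow r i)
    semPow-mono r zero = e-mono 𝟙
    semPow-mono r (suc i) b b' Bb Bb' b⊑b' = ext-mono (semPow r i) (⟦⟧B-mono r b b' Bb Bb' b⊑b')

  semPow≗⟦pow⟧B : ∀ r i b → semPow r i b ≡ ⟦ pow r i ⟧B b
  semPow≗⟦pow⟧B r zero b = refl
  semPow≗⟦pow⟧B r (suc i) b = ext-cong (semPow≗⟦pow⟧B r i) (⟦ r ⟧B b)

  module _ (⟦⟧-additive : ∀ r → Additive ⟦ r ⟧) (⨁-additive : ⨁PreservesAdditivity) where

    ext-semPow-additive : ∀ r i → Additive (ext (semPow r i))
    ext-semPow-additive r i =
      Additive-cong (λ d → sym (ext-cong (semPow≗⟦pow⟧B r i) d)) (⟦⟧-additive (pow r i))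

    ⟦⟧-⨾-⊑ : ∀ r₁ r₂ h → ⟦ r₂ ⟧ (⟦ r₁ ⟧ h) ⊑ ⟦ r₁ ⨾ r₂ ⟧ h
    ⟦⟧-⨾-⊑ r₁ r₂ = additive-ext-⊑ (⟦⟧-additive r₂) ⟦ r₁ ⟧B

    ⟦⟧-+-⊑ : ∀ r₁ r₂ h → ⟦ r₁ ⟧ h ⊕ ⟦ r₂ ⟧ h ⊑ ⟦ r₁ +ᶜ r₂ ⟧ h
    ⟦⟧-+-⊑ r₁ r₂ h = ⊑-trans (⨁-mono Bool _ _ λ { true → ⊑-refl ; false → ⊑-refl })
      (⨁-ext-⊑ ⨁-additive branch
        (λ { true → ⟦⟧-additive r₁ ; false → ⟦⟧-additive r₂ })
        (λ { true → ⟦⟧B-mono r₁ ; false → ⟦⟧B-mono r₂ }) h)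
      where
        branch : Bool → D → D
        branch c b = if c then ⟦ r₁ ⟧B b else ⟦ r₂ ⟧B b

    -- Tail iteration (iterate) follows semPow, which runs r before rⁱ; the iter
    -- rule needs head iteration (fold), hence iterate-is-fold below.
    iterate-⊑-ext-semPow : ∀ r i h → iterate ⟦ r ⟧ h i ⊑ ext (semPow r i) h
    iterate-⊑-ext-semPow r zero h = ⊑-ext (λ b Bb → ≡⇒⊑ (sym (𝟙-sem b Bb))) h
    iterate-⊑-ext-semPow r (suc i) h = ⊑-trans (iterate-⊑-ext-semPow r i (⟦ r ⟧ h))
      (additive-ext-⊑ (ext-semPow-additive r i) ⟦ r ⟧B h)

    ⟦⟧-*-⊑ : ∀ r h → ⨁ (fold h ⟦ r ⟧) ⊑ ⟦ r *ᶜ ⟧ h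
    ⟦⟧-*-⊑ r h = ⊑-trans
      (⨁-mono ℕ _ _ λ i → subst (_⊑ ext (semPow r i) h) (sym (iterate-is-fold h ⟦ r ⟧ i))
        (iterate-⊑-ext-semPow r i h))
      (⨁-ext-⊑ ⨁-additive (semPow r) (ext-semPow-additive r) (semPow-mono r) h)

    completeness : ∀ h k r → ⟦ r ⟧ h ⊑ k → ⊢⟨ h ⟩ r ⟨ k ⟩
    completeness h k (elem e) ⟦r⟧h⊑k = basic ⟦r⟧h⊑k
    completeness h k (r₁ ⨾ r₂) ⟦r⟧h⊑k = seq (completeness h _ r₁ ⊑-refl)
      (completeness _ k r₂ (⊑-trans (⟦⟧-⨾-⊑ r₁ r₂ h) ⟦r⟧h⊑k))
    completeness h k (r₁ +ᶜ r₂) ⟦r⟧h⊑k = choice (completeness h _ r₁ ⊑-refl)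
      (completeness h _ r₂ ⊑-refl) (⊑-trans (⟦⟧-+-⊑ r₁ r₂ h) ⟦r⟧h⊑k)
    completeness h k (r *ᶜ) ⟦r⟧h⊑k = iter (fold h ⟦ r ⟧) (λ i → completeness _ _ r ⊑-refl)
      (⊑-trans (⟦⟧-*-⊑ r h) ⟦r⟧h⊑k)

proposition3p6 : (P : PreInterpretationMonoid) → IsInterpretationMonoid P →
    (S : BasisSemantics P) →
    let open Semantics P S in
    (∀ d → B d ⇔ (Ir d ⊎ d ≡ ⊥D)) →
    (∀ (r : Cmd) → Additive ⟦ r ⟧) →
    (∀ (I : Set) (f : I → D → D) → (∀ i → Additive (f i)) →
      Additive (λ d → ⨁ (λ i → f i d))) →
    ∀ (h k : D) (r : Cmd) → ⟦ r ⟧ h ⊑ k → ⊢⟨ h ⟩ r ⟨ k ⟩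
proposition3p6 P _ S _ ⟦⟧-additive ⨁-additive =
  Completeness.completeness P S ⟦⟧-additive ⨁-additive
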